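{- Let $G$ be a group and $A\subseteq G$. If $A$ is almost P-small or weakly P-small, then $G\setminus\Delta(A)$ is infinite.
   Context: For $A\subseteq G$, $\Delta(A)=\{g\in G:|gA\cap A|=\infty\}$. $A$ is almost P-small if there is an injective sequence $(g_n)_{n\in\omega}$ in $G$ such that $g_nA\cap g_mA$ is finite for all distinct $n,m$. $A$ is weakly P-small if for every $n\in\omega$ there exist distinct $g_1,\dots,g_n\in G$ such that $g_1A,\dots,g_nA$ are pairwise disjoint. -}

module Defs where

open import Level using (Level; _⊔_)
open import Data.Nat using (ℕ)
open import Data.Fin using (Fin)
open import Data.List using (List)
open import Data.List.Relation.Unary.Any using (Any)
open import Data.Product using (Σ; ∃; ∃-syntax; _×_)
open import Relation.Nullary using (¬_)
open import Relation.Binary.PropositionalEquality using (_≡_; _≢_)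
open import Algebra.Bundles using (Group)

module _ {c ℓ : Level} (G : Group c ℓ) where
  open Group G

  Subset : (a : Level) → Set (c ⊔ Level.suc a)
  Subset a = Carrier → Set a

  _·_ : ∀ {a} → Carrier → Subset a → Subset (c ⊔ ℓ ⊔ a)
  (g · A) x = ∃[ y ] (A y × x ≈ g ∙ y)

  _∩_ : ∀ {a b} → Subset a → Subset b → Subset (a ⊔ b)
  (S ∩ T) x = S x × T x

  Finite : ∀ {a} → Subset a → Set (c ⊔ ℓ ⊔ a)
  Finite S = Σ (List Carrier) λ xs → ∀ x → S x → Any (x ≈_) xs

  Infinite : ∀ {a} → Subset a → Set (c ⊔ ℓ ⊔ a)
  Infinite S = ¬ Finite S

  Δ : ∀ {a} → Subset a → Subset (c ⊔ ℓ ⊔ a)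
  Δ A g = Infinite ((g · A) ∩ A)

  ∁ : ∀ {a} → Subset a → Subset a
  ∁ S g = ¬ S g

  AlmostPSmall : ∀ {a} → Subset a → Set (c ⊔ ℓ ⊔ a)
  AlmostPSmall A =
    Σ (ℕ → Carrier) λ g →
      (∀ n m → g n ≈ g m → n ≡ m) ×
      (∀ n m → n ≢ m → Finite ((g n · A) ∩ (g m · A)))

  WeaklyPSmall : ∀ {a} → Subset a → Set (c ⊔ ℓ ⊔ a)
  WeaklyPSmall A =
    ∀ (n : ℕ) → Σ (Fin n → Carrier) λ g →
      (∀ i j → i ≢ j → ¬ (g i ≈ g j)) ×
      (∀ i j → i ≢ j → ∀ x → ¬ (((g i · A) ∩ (g j · A)) x))

module Submission where

-- Both hypotheses give, for every n, distinct g₀, g₁, …, gₙ such that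
-- g₀A ∩ gᵢA is finite (empty, in the weak case) for i ≥ 1.  Translating on the
-- left by g₀⁻¹ maps (g₀⁻¹gᵢ)A ∩ A into g₀⁻¹(g₀A ∩ gᵢA), so each hᵢ = g₀⁻¹gᵢ
-- has (hᵢA ∩ A) finite, i.e. hᵢ ∉ Δ(A); and the hᵢ are distinct by left
-- cancellation.  Hence G ∖ Δ(A) contains n distinct elements for every n, and a
-- pigeonhole argument shows that no finite set can do that.

open import Defs
open import Level using (Level)
open import Algebra.Bundles using (Group)
open import Data.Nat using (ℕ; suc)
open import Data.Nat.Properties using (n<1+n)
open import Data.Fin using (Fin; toℕ) renaming (zero to fzero; suc to fsuc)
import Data.Fin.Properties as Fin
open import Data.List using ([]; length; lookup; map)
open import Data.List.Relation.Unary.Any as Any using (index)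
open import Data.List.Relation.Unary.Any.Properties using (lookup-index; map⁺)
open import Data.Product using (Σ; _×_; _,_)
open import Data.Sum using (_⊎_; [_,_])
open import Data.Empty using (⊥-elim)
open import Relation.Nullary using (¬_)
open import Relation.Unary using (_⊆_)
open import Relation.Binary.Definitions using (_Respects_)
open import Relation.Binary.PropositionalEquality using (_≢_; cong)

module _ {c ℓ : Level} (G : Group c ℓ) where
  open Group G
  open import Algebra.Properties.Group G using (∙-cancelˡ; \\-leftDividesˡ)

  infixr 8 _·ᴳ_
  infixr 7 _∩ᴳ_

  _·ᴳ_ : ∀ {a} → Carrier → Subset G a → Subset G _
  _·ᴳ_ = _·_ G

  _∩ᴳ_ : ∀ {a b} → Subset G a → Subset G b → Subset G _
  _∩ᴳ_ = _∩_ G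

  DistinctFamilyIn : ∀ {a} → ℕ → Subset G a → Set _
  DistinctFamilyIn n S =
    Σ (Fin n → Carrier) λ h → (∀ i j → i ≢ j → ¬ (h i ≈ h j)) × (∀ i → S (h i))

  finite-⊆ : ∀ {a b} {S : Subset G a} {T : Subset G b} → S ⊆ T → Finite G T → Finite G S
  finite-⊆ S⊆T (xs , cover) = xs , λ x Sx → cover x (S⊆T Sx)

  empty-finite : ∀ {a} {S : Subset G a} → (∀ x → ¬ S x) → Finite G S
  empty-finite empty = [] , λ x Sx → ⊥-elim (empty x Sx)

  preimage-finite : ∀ {a} {S : Subset G a} g → Finite G S → Finite G (λ x → S (g ∙ x))
  preimage-finite g (xs , cover) = map (g ⁻¹ ∙_) xs , λ x Sgx →
    map⁺ (Any.map (λ {y} gx≈y → ∙-cancelˡ g x _ (trans gx≈y (sym (\\-leftDividesˡ g y))))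
                  (cover (g ∙ x) Sgx))

  -- Pigeonhole: a set covered by a list xs contains no 1 + |xs| distinct elements,
  -- since two of them would be ≈ to the same entry of xs.
  finite-bounded : ∀ {a} {S : Subset G a} ((xs , _) : Finite G S) →
                   ¬ DistinctFamilyIn (suc (length xs)) S
  finite-bounded (xs , cover) (h , distinct , inS)
    with Fin.pigeonhole (n<1+n (length xs)) (λ i → index (cover (h i) (inS i)))
  ... | i , j , i<j , same-entry =
    distinct i j (Fin.<⇒≢ i<j)
      (trans (lookup-index (cover (h i) (inS i)))
        (trans (reflexive (cong (lookup xs) same-entry))
               (sym (lookup-index (cover (h j) (inS j))))))

  unbounded-infinite : ∀ {a} {S : Subset G a} → (∀ n → DistinctFamilyIn n S) → Infinite G S
  unbounded-infinite families fin@(xs , _) = finite-bounded fin (families (suc (length xs)))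

  module _ {a} (A : Subset G a) where

    translate-intersection : ∀ g h →
      ((g ⁻¹ ∙ h) ·ᴳ A) ∩ᴳ A ⊆ (λ x → ((g ·ᴳ A) ∩ᴳ (h ·ᴳ A)) (g ∙ x))
    translate-intersection g h {x} ((y , Ay , x≈g⁻¹hy) , Ax) =
      (x , Ax , refl) , (y , Ay , g∙x≈h∙y)
      where
      open import Relation.Binary.Reasoning.Setoid setoid
      g∙x≈h∙y : g ∙ x ≈ h ∙ y
      g∙x≈h∙y = begin
        g ∙ x                ≈⟨ ∙-congˡ x≈g⁻¹hy ⟩
        g ∙ (g ⁻¹ ∙ h ∙ y)   ≈⟨ ∙-congˡ (assoc (g ⁻¹) h y) ⟩
        g ∙ (g ⁻¹ ∙ (h ∙ y)) ≈⟨ \\-leftDividesˡ g (h ∙ y) ⟩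
        h ∙ y                ∎

    almost-disjoint-∉Δ : ∀ g h → Finite G ((g ·ᴳ A) ∩ᴳ (h ·ᴳ A)) → ∁ G (Δ G A) (g ⁻¹ ∙ h)
    almost-disjoint-∉Δ g h fin infinite =
      infinite (finite-⊆ (translate-intersection g h) (preimage-finite g fin))

    SmallFamily : ℕ → Set _
    SmallFamily n =
      Σ (Fin (suc n) → Carrier) λ g → (∀ i j → i ≢ j → ¬ (g i ≈ g j)) ×
        (∀ i → Finite G ((g fzero ·ᴳ A) ∩ᴳ (g (fsuc i) ·ᴳ A)))

    small-family-∉Δ : ∀ n → SmallFamily n → DistinctFamilyIn n (∁ G (Δ G A))
    small-family-∉Δ n (g , distinct , fin) =
      (λ i → g fzero ⁻¹ ∙ g (fsuc i)) ,
      (λ i j i≢j eq → distinct (fsuc i) (fsuc j) (λ si≡sj → i≢j (Fin.suc-injective si≡sj))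
                               (∙-cancelˡ (g fzero ⁻¹) _ _ eq)) ,
      (λ i → almost-disjoint-∉Δ (g fzero) (g (fsuc i)) (fin i))

    almost-small-families : AlmostPSmall G A → ∀ n → SmallFamily n
    almost-small-families (g , injective , fin) n =
      (λ i → g (toℕ i)) ,
      (λ i j i≢j eq → i≢j (Fin.toℕ-injective (injective (toℕ i) (toℕ j) eq))) ,
      (λ i → fin 0 (suc (toℕ i)) (λ ()))

    weakly-small-families : WeaklyPSmall G A → ∀ n → SmallFamily n
    weakly-small-families weak n with weak (suc n)
    ... | g , distinct , disjoint =
      g , distinct , λ i → empty-finite (disjoint fzero (fsuc i) (λ ()))

-- Theorem 3.4.
theorem3p4 : ∀ {c ℓ a : Level} (G : Group c ℓ) (A : Subset G a) →
    A Respects (Group._≈_ G) →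
    AlmostPSmall G A ⊎ WeaklyPSmall G A →
    Infinite G (∁ G (Δ G A))
theorem3p4 G A _ small = unbounded-infinite G λ n → small-family-∉Δ G A n (families n)
  where
  families : ∀ n → SmallFamily G A n
  families = [ almost-small-families G A , weakly-small-families G A ] small
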